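{- Let $e\ge1$ and $0\le k<2^{e-1}$ be integers. Then $$\nu\Bigl(\sum_{i=0}^k\bigl(\tbinom{2^e+2k+1}i^{ -1}-\tbinom{2k+1}i^{ -1}\bigr)\Bigr)\ge e-2\lg(k+2)+2\nu(k+1).$$ Indeed, setting $T_i:=\binom{2^e+2k+1}i^{ -1}-\binom{2k+1}i^{ -1}$, we have: (a) if $0\le i\le\lfloor (k-1)/2\rfloor$, then $\nu(T_{2i}+T_{2i+1})\ge e-2\lg(k+1)+2\nu(k+1)$; and (b) if $k$ is even, then $\nu(T_k)\ge e-2\lg(k+2)$.
   Context: $\nu(-)$ denotes the exponent of $2$ in a rational number (2-adic valuation, $\nu(0)=\infty$). $\lg(y)=\lfloor\log_2 y\rfloor$. -}

module Defs where

open import Data.Nat using (ℕ; zero; suc; _+_; _*_; _^_; _%_; ⌊_/2⌋)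
open import Data.Nat.Combinatorics using (_C_)
open import Data.Nat.Logarithm using (⌊log₂_⌋)
open import Data.Integer as ℤ using (ℤ; +_)
open import Data.Rational as ℚ using (ℚ; ↥_; ↧ₙ_; 0ℚ)
open import Data.Sum using (_⊎_)
open import Relation.Binary.PropositionalEquality using (_≡_)

-- 2-adic valuation of a natural number (fuel-based; fuel n suffices).
-- ν₂ℕ 0 = 0 is junk and never relevant below.
v2-aux : ℕ → ℕ → ℕ
v2-aux zero n = 0
v2-aux (suc f) zero = 0
v2-aux (suc f) (suc m) with suc m % 2
... | zero = suc (v2-aux f ⌊ suc m /2⌋)
... | suc _ = 0

ν₂ℕ : ℕ → ℕ
ν₂ℕ n = v2-aux n n

-- 2-adic valuation of a nonzero rational in lowest terms: ν(num) - ν(den).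
-- (The value at 0 is junk; ν(0) = ∞ is handled by νAtLeast.)
νℚ : ℚ → ℤ
νℚ q = (+ ν₂ℕ ℤ.∣ ↥ q ∣) ℤ.- (+ ν₂ℕ (↧ₙ q))

-- "ν(q) ≥ m", with the convention ν(0) = ∞.
νAtLeast : ℤ → ℚ → Set
νAtLeast m q = q ≡ 0ℚ ⊎ m ℤ.≤ νℚ q

lg : ℕ → ℕ
lg y = ⌊log₂ y ⌋

-- 1/n as a rational (only used for n ≥ 1; value at 0 is junk).
inv : ℕ → ℚ
inv zero = 0ℚ
inv (suc n) = (+ 1) ℚ./ suc n

T : ℕ → ℕ → ℕ → ℚ
T e k i = inv ((2 ^ e + 2 * k + 1) C i) ℚ.- inv ((2 * k + 1) C i)

sumUpTo : (ℕ → ℚ) → ℕ → ℚ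
sumUpTo f zero = f 0
sumUpTo f (suc k) = sumUpTo f k ℚ.+ f (suc k)

module Submission where

-- Write 1/C(x, r) = r!/(x P′ r).  The shift lemma: P = n P′ r and P + D = (n + 2^e) P′ r
-- have equal valuation and ν(D) ≥ e + ν(P) − lg n.  So T_r = −r!·D/(P(P + D)), and by
-- 1/C(x, a) + 1/C(x, a+1) = a!(x+1)/(x P′ (a+1)) a pair has numerator a!·2^e·P − a!(n+1)·D.
-- This yields term-bound and pair-bound, reducing (b) and (a) to inequalities between
-- ν(P) = F(n) − F(n − r), with F(m) = ν(m!), and lg.  These follow from Legendre's recursion
-- F(r + 2h) = h + F(h) via the Kummer-type carry bound F(c+i+j) ≤ lg(c+i+j) + F(i) + F(j)
-- and the digit bound m ≤ F(m) + lg(m+1).  Rational valuation bounds ν(x) ≥ p − q are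
-- stated over ℕ as 2^(p + ν(den x)) ∣ 2^q·|num x| (Bound p q x), which is closed under +.

open import Defs
open import Data.Nat.Base
  using (ℕ; zero; suc; _+_; _*_; _^_; _∸_; _%_; _≤_; _<_; z≤n; s≤s; s≤s⁻¹; _!; ⌊_/2⌋; NonZero; >-nonZero; ≢-nonZero)
open import Data.Nat.Properties
open import Data.Nat.Divisibility
open import Data.Nat.DivMod using ([m+kn]%n≡m%n; m*n%n≡0; _/_; m/n*n≡m)
open import Data.Nat.Combinatorics using (_C_; nCk≡nPk/k!; k![n∸k]!∣n!)
open import Data.Nat.Combinatorics.Base using (_P′_; _P_)
open import Data.Nat.Combinatorics.Specification using (nP′k≡n!/[n∸k]!; nPk≡n!/[n∸k]!; k!∣nP′k)
open import Data.Nat.Induction using (<-rec)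
open import Data.Nat.Logarithm using (⌊log₂⌋-mono-≤; ⌊log₂[2^n]⌋≡n; ⌊log₂[2*b]⌋≡1+⌊log₂b⌋)
open import Data.Nat.Tactic.RingSolver using (solve-∀)
open import Data.Integer as ℤ using (+_; ∣_∣)
import Data.Integer.Properties as ℤP
import Data.Integer.Divisibility.Signed as ℤ∣
import Data.Integer.Tactic.RingSolver as ℤ-Solver
open import Data.Rational.Unnormalised as ℚᵘ using (ℚᵘ; mkℚᵘ; _≃_; *≡*)
import Data.Rational.Unnormalised.Properties as ℚᵘP
open import Data.Rational.Unnormalised.Solver using (module +-*-Solver)
open import Data.Rational as ℚ using (ℚ; mkℚ; toℚᵘ)
import Data.Rational.Properties as ℚP
open import Data.Product using (∃; ∃₂; _,_; _×_)
open import Data.Sum using (inj₁; inj₂)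
open import Relation.Nullary using (¬_; yes; no; contradiction)
open import Relation.Binary.PropositionalEquality

halve : ∀ n → ∃₂ λ r h → r ≤ 1 × n ≡ r + h * 2
halve zero = 0 , 0 , z≤n , refl
halve (suc n) with halve n
... | 0 , h , _ , refl = 1 , h , s≤s z≤n , refl
... | 1 , h , _ , refl = 0 , suc h , z≤n , refl
... | suc (suc _) , _ , s≤s () , _

half-≤ : ∀ {r a f} → r + a * 2 ≤ suc f → a ≤ f
half-≤ {r} {zero} _ = z≤n
half-≤ {r} {suc a} le = ≤-trans (s≤s (m≤m*n a 2)) (s≤s⁻¹ (≤-trans (m≤n+m _ r) le))

v2-aux-fuel : ∀ f g m → m ≤ f → m ≤ g → v2-aux f m ≡ v2-aux g m
v2-aux-fuel zero    zero    zero    _       _       = refl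
v2-aux-fuel zero    (suc g) zero    _       _       = refl
v2-aux-fuel (suc f) zero    zero    _       _       = refl
v2-aux-fuel (suc f) (suc g) zero    _       _       = refl
v2-aux-fuel (suc f) (suc g) (suc m) (s≤s p) (s≤s q) with suc m % 2
... | zero  = cong suc (v2-aux-fuel f g ⌊ suc m /2⌋ (≤-trans half<m p) (≤-trans half<m q))
  where half<m = s≤s⁻¹ (⌊n/2⌋<n m)
... | suc _ = refl

ν-odd : ∀ j → ν₂ℕ (1 + j * 2) ≡ 0
ν-odd j = unfold (j * 2) ([m+kn]%n≡m%n 1 j 2)
  where
  unfold : ∀ x → suc x % 2 ≡ 1 → v2-aux (suc x) (suc x) ≡ 0
  unfold x odd with suc x % 2 | odd
  ... | suc zero | refl = refl

ν-double : ∀ h .{{_ : NonZero h}} → ν₂ℕ (h * 2) ≡ suc (ν₂ℕ h)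
ν-double (suc h) = unfold (suc (h * 2)) refl (m*n%n≡0 (suc h) 2)
  where
  unfold : ∀ x → suc x ≡ suc h * 2 → suc x % 2 ≡ 0 →
           v2-aux (suc x) (suc x) ≡ suc (ν₂ℕ (suc h))
  unfold x x≡ even with suc x % 2 | even
  ... | zero | refl = cong suc (begin
    v2-aux x ⌊ suc x /2⌋     ≡⟨ v2-aux-fuel x (suc h) _ (s≤s⁻¹ (⌊n/2⌋<n x)) (≤-reflexive half≡) ⟩
    v2-aux (suc h) ⌊ suc x /2⌋ ≡⟨ cong (v2-aux (suc h)) half≡ ⟩
    ν₂ℕ (suc h)              ∎)
    where
    open ≡-Reasoning
    half≡ : ⌊ suc x /2⌋ ≡ suc h
    half≡ = trans (cong ⌊_/2⌋ x≡) (n*2/2 (suc h))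
      where
      n*2/2 : ∀ n → ⌊ n * 2 /2⌋ ≡ n
      n*2/2 zero = refl
      n*2/2 (suc n) = cong suc (n*2/2 n)

ν-pow*odd : ∀ c j → ν₂ℕ (2 ^ c * (1 + j * 2)) ≡ c
ν-pow*odd zero j = trans (cong ν₂ℕ (+-identityʳ (1 + j * 2))) (ν-odd j)
ν-pow*odd (suc c) j = begin
  ν₂ℕ (2 ^ suc c * o)   ≡⟨ cong ν₂ℕ (trans (*-assoc 2 (2 ^ c) o) (*-comm 2 (2 ^ c * o))) ⟩
  ν₂ℕ (2 ^ c * o * 2)   ≡⟨ ν-double (2 ^ c * o) {{m*n≢0 (2 ^ c) o {{m^n≢0 2 c}}}} ⟩
  suc (ν₂ℕ (2 ^ c * o)) ≡⟨ cong suc (ν-pow*odd c j) ⟩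
  suc c                 ∎
  where
  open ≡-Reasoning
  o = 1 + j * 2

odd-part : ∀ y .{{_ : NonZero y}} → ∃ λ j → y ≡ 2 ^ ν₂ℕ y * (1 + j * 2)
odd-part = <-rec _ step
  where
  step : ∀ y → (∀ {z} → z < y → .{{_ : NonZero z}} → ∃ λ j → z ≡ 2 ^ ν₂ℕ z * (1 + j * 2)) →
         .{{_ : NonZero y}} → ∃ λ j → y ≡ 2 ^ ν₂ℕ y * (1 + j * 2)
  step y rec with halve y
  ... | 1 , h , _ , refl = h , sym (trans (cong (λ v → 2 ^ v * (1 + h * 2)) (ν-odd h)) (*-identityˡ _))
  ... | suc (suc _) , _ , s≤s () , _
  ... | 0 , suc h , _ , refl with rec {suc h} (s≤s (s≤s (m≤m*n h 2)))
  ...   | j , eq = j , (begin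
    suc h * 2                          ≡⟨ cong (_* 2) eq ⟩
    2 ^ ν₂ℕ (suc h) * o * 2            ≡⟨ *-comm (2 ^ ν₂ℕ (suc h) * o) 2 ⟩
    2 * (2 ^ ν₂ℕ (suc h) * o)          ≡⟨ *-assoc 2 (2 ^ ν₂ℕ (suc h)) o ⟨
    2 ^ suc (ν₂ℕ (suc h)) * o          ≡⟨ cong (λ v → 2 ^ v * o) (ν-double (suc h)) ⟨
    2 ^ ν₂ℕ (suc h * 2) * o            ∎)
    where
    open ≡-Reasoning
    o = 1 + j * 2

ν-* : ∀ x y .{{_ : NonZero x}} .{{_ : NonZero y}} → ν₂ℕ (x * y) ≡ ν₂ℕ x + ν₂ℕ y
ν-* x y with odd-part x | odd-part y
... | i , x≡ | j , y≡ = trans (cong ν₂ℕ xy≡) (ν-pow*odd (ν₂ℕ x + ν₂ℕ y) (i + j + i * j * 2))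
  where
  xy≡ : x * y ≡ 2 ^ (ν₂ℕ x + ν₂ℕ y) * (1 + (i + j + i * j * 2) * 2)
  xy≡ = begin
    x * y                                              ≡⟨ cong₂ _*_ x≡ y≡ ⟩
    (2 ^ ν₂ℕ x * (1 + i * 2)) * (2 ^ ν₂ℕ y * (1 + j * 2)) ≡⟨ regroup (2 ^ ν₂ℕ x) (2 ^ ν₂ℕ y) i j ⟩
    2 ^ ν₂ℕ x * 2 ^ ν₂ℕ y * (1 + (i + j + i * j * 2) * 2) ≡⟨ cong (_* _) (^-distribˡ-+-* 2 (ν₂ℕ x) (ν₂ℕ y)) ⟨
    2 ^ (ν₂ℕ x + ν₂ℕ y) * (1 + (i + j + i * j * 2) * 2)  ∎
    where
    open ≡-Reasoning
    regroup : ∀ a b i j → (a * (1 + i * 2)) * (b * (1 + j * 2)) ≡ a * b * (1 + (i + j + i * j * 2) * 2)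
    regroup = solve-∀

ν-pow : ∀ q → ν₂ℕ (2 ^ q) ≡ q
ν-pow q = trans (cong ν₂ℕ (sym (*-identityʳ (2 ^ q)))) (ν-pow*odd q 0)

pow-∣ : ∀ {a b} → a ≤ b → 2 ^ a ∣ 2 ^ b
pow-∣ {a} {b} a≤b = divides (2 ^ (b ∸ a)) (trans (cong (2 ^_) (sym (m∸n+n≡m a≤b))) (^-distribˡ-+-* 2 (b ∸ a) a))

pow-ν∣ : ∀ y → 2 ^ ν₂ℕ y ∣ y
pow-ν∣ zero = _ ∣0
pow-ν∣ y@(suc _) with odd-part y
... | j , y≡ = divides (1 + j * 2) (trans y≡ (*-comm _ (1 + j * 2)))

pow∣⇒≤ν : ∀ a y .{{_ : NonZero y}} → 2 ^ a ∣ y → a ≤ ν₂ℕ y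
pow∣⇒≤ν a y 2^a∣y with a ≤? ν₂ℕ y
... | yes a≤ν = a≤ν
... | no a≰ν with odd-part y
...   | j , y≡ = contradiction (*-cancelˡ-∣ (2 ^ ν₂ℕ y) {{m^n≢0 2 (ν₂ℕ y)}} 2*2^ν∣2^ν*odd) (odd-not-even j)
  where
  2*2^ν∣2^ν*odd : 2 ^ ν₂ℕ y * 2 ∣ 2 ^ ν₂ℕ y * (1 + j * 2)
  2*2^ν∣2^ν*odd = subst₂ _∣_ (*-comm 2 (2 ^ ν₂ℕ y)) y≡ (∣-trans (pow-∣ (≰⇒> a≰ν)) 2^a∣y)
  odd-not-even : ∀ j → ¬ (2 ∣ 1 + j * 2)
  odd-not-even j 2∣odd with ∣⇒≤ (∣m+n∣m⇒∣n (subst (2 ∣_) (+-comm 1 (j * 2)) 2∣odd) (n∣m*n j))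
  ... | s≤s ()

≤ν⇒pow∣ : ∀ {a} y → a ≤ ν₂ℕ y → 2 ^ a ∣ y
≤ν⇒pow∣ y a≤ν = ∣-trans (pow-∣ a≤ν) (pow-ν∣ y)

ν≤lg : ∀ y .{{_ : NonZero y}} → ν₂ℕ y ≤ lg y
ν≤lg y = begin
  ν₂ℕ y            ≡⟨ ⌊log₂[2^n]⌋≡n (ν₂ℕ y) ⟨
  lg (2 ^ ν₂ℕ y)   ≤⟨ ⌊log₂⌋-mono-≤ (∣⇒≤ (pow-ν∣ y)) ⟩
  lg y             ∎
  where open ≤-Reasoning

ν<exponent : ∀ {y} e .{{_ : NonZero y}} → y < 2 ^ e → ν₂ℕ y < e
ν<exponent {y} e y<2^e with ν₂ℕ y <? e
... | yes ν<e = ν<e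
... | no  ν≮e = contradiction (≤-<-trans 2^e≤y y<2^e) (<-irrefl refl)
  where 2^e≤y = ≤-trans (^-monoʳ-≤ 2 (≮⇒≥ ν≮e)) (∣⇒≤ (pow-ν∣ y))

ν-+-higher : ∀ x y .{{_ : NonZero x}} → 2 ^ suc (ν₂ℕ x) ∣ y → ν₂ℕ (x + y) ≡ ν₂ℕ x
ν-+-higher x y (divides w y≡) with odd-part x
... | j , x≡ = trans (cong ν₂ℕ x+y≡) (ν-pow*odd (ν₂ℕ x) (j + w))
  where
  x+y≡ : x + y ≡ 2 ^ ν₂ℕ x * (1 + (j + w) * 2)
  x+y≡ = trans (cong₂ _+_ x≡ y≡) (collect (2 ^ ν₂ℕ x) j w)
    where
    collect : ∀ p j w → p * (1 + j * 2) + w * (2 * p) ≡ p * (1 + (j + w) * 2)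
    collect = solve-∀

ν-pow* : ∀ q W .{{_ : NonZero W}} → ν₂ℕ (2 ^ q * W) ≡ q + ν₂ℕ W
ν-pow* q W = trans (ν-* (2 ^ q) W {{m^n≢0 2 q}}) (cong (_+ ν₂ℕ W) (ν-pow q))

≤⇒pow∣pow* : ∀ a q W .{{_ : NonZero W}} → a ≤ q + ν₂ℕ W → 2 ^ a ∣ 2 ^ q * W
≤⇒pow∣pow* a q W a≤ = ≤ν⇒pow∣ (2 ^ q * W) (subst (a ≤_) (sym (ν-pow* q W)) a≤)

pow∣pow*⇒≤ : ∀ a q W .{{_ : NonZero W}} → 2 ^ a ∣ 2 ^ q * W → a ≤ q + ν₂ℕ W
pow∣pow*⇒≤ a q W d = subst (a ≤_) (ν-pow* q W) (pow∣⇒≤ν a (2 ^ q * W) {{m*n≢0 (2 ^ q) W {{m^n≢0 2 q}}}} d)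

pow∣-cancel : ∀ a y w .{{_ : NonZero w}} → 2 ^ (a + ν₂ℕ w) ∣ y * w → 2 ^ a ∣ y
pow∣-cancel a zero      w _ = _ ∣0
pow∣-cancel a y@(suc _) w d =
  ≤ν⇒pow∣ y (+-cancelʳ-≤ (ν₂ℕ w) a (ν₂ℕ y) (subst (a + ν₂ℕ w ≤_) (ν-* y w) (pow∣⇒≤ν _ (y * w) {{m*n≢0 y w}} d)))

pow∣-scale : ∀ α m D γ q W .{{_ : NonZero W}} →
             2 ^ α ∣ 2 ^ m * D → m + γ ≤ α + (q + ν₂ℕ W) → 2 ^ γ ∣ 2 ^ q * (W * D)
pow∣-scale α m D γ q W d ineq = *-cancelˡ-∣ (2 ^ m) {{m^n≢0 2 m}} (begin
  2 ^ m * 2 ^ γ                   ≡⟨ ^-distribˡ-+-* 2 m γ ⟨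
  2 ^ (m + γ)                     ∣⟨ pow-∣ ineq ⟩
  2 ^ (α + (q + ν₂ℕ W))           ≡⟨ ^-distribˡ-+-* 2 α (q + ν₂ℕ W) ⟩
  2 ^ α * 2 ^ (q + ν₂ℕ W)         ∣⟨ *-pres-∣ d (≤⇒pow∣pow* (q + ν₂ℕ W) q W ≤-refl) ⟩
  2 ^ m * D * (2 ^ q * W)         ≡⟨ regroup (2 ^ m) D (2 ^ q) W ⟩
  2 ^ m * (2 ^ q * (W * D))       ∎)
  where
  open ∣-Reasoning
  regroup : ∀ a d b w → a * d * (b * w) ≡ a * (b * (w * d))
  regroup = solve-∀

F : ℕ → ℕ
F m = ν₂ℕ (m !)

F-suc : ∀ m → F (suc m) ≡ ν₂ℕ (suc m) + F m
F-suc m = ν-* (suc m) (m !) {{_}} {{m !≢0}}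

F-double : ∀ h → F (h * 2) ≡ h + F h
F-double+1 : ∀ h → F (1 + h * 2) ≡ h + F h
F-double zero = refl
F-double (suc h) = begin
  F (suc (suc (h * 2)))                ≡⟨ F-suc (suc (h * 2)) ⟩
  ν₂ℕ (suc h * 2) + F (1 + h * 2)       ≡⟨ cong₂ _+_ (ν-double (suc h)) (F-double+1 h) ⟩
  suc (ν₂ℕ (suc h)) + (h + F h)         ≡⟨ shuffle (ν₂ℕ (suc h)) h (F h) ⟩
  suc h + (ν₂ℕ (suc h) + F h)           ≡⟨ cong (_+_ (suc h)) (F-suc h) ⟨
  suc h + F (suc h)                     ∎
  where
  open ≡-Reasoning
  shuffle : ∀ v h f → suc v + (h + f) ≡ suc h + (v + f)
  shuffle = solve-∀
F-double+1 h = trans (F-suc (h * 2)) (cong₂ _+_ (ν-odd h) (F-double h))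

F-halve : ∀ {r} h → r ≤ 1 → F (r + h * 2) ≡ h + F h
F-halve h z≤n       = F-double h
F-halve h (s≤s z≤n) = F-double+1 h

lg-double : ∀ h .{{_ : NonZero h}} → lg (h * 2) ≡ suc (lg h)
lg-double h = trans (cong lg (*-comm h 2)) (⌊log₂[2*b]⌋≡1+⌊log₂b⌋ h)

lg-carry : ∀ {c} h r → c ≤ 1 → c ≤ h → c + lg h ≤ lg (r + h * 2)
lg-carry h r z≤n _ = ⌊log₂⌋-mono-≤ (≤-trans (m≤m*n h 2) (m≤n+m (h * 2) r))
lg-carry h@(suc _) r (s≤s z≤n) _ = begin
  suc (lg h)    ≡⟨ lg-double h ⟨
  lg (h * 2)    ≤⟨ ⌊log₂⌋-mono-≤ (m≤n+m (h * 2) r) ⟩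
  lg (r + h * 2) ∎
  where open ≤-Reasoning

carry-bound : ∀ c i j → c ≤ 1 → F (c + i + j) ≤ lg (c + i + j) + F i + F j
carry-bound c i j c≤1 = go (i + j) c i j c≤1 (m≤m+n i j) (m≤n+m j i)
  where
  carry≤1 : ∀ {c'} r' → r' + c' * 2 ≤ 3 → c' ≤ 1
  carry≤1 {zero} _ _ = z≤n
  carry≤1 {suc zero} _ _ = s≤s z≤n
  carry≤1 {suc (suc c')} r' le with ≤-trans (m≤n+m _ r') le
  ... | s≤s (s≤s (s≤s ()))

  go : ∀ f c i j → c ≤ 1 → i ≤ f → j ≤ f → F (c + i + j) ≤ lg (c + i + j) + F i + F j
  go zero zero          zero    zero    _        _ _ = z≤n
  go zero (suc zero)    zero    zero    _        _ _ = z≤n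
  go zero (suc (suc _)) _       _       (s≤s ()) _ _
  go (suc f) c i j c≤1 i≤ j≤ with halve i | halve j
  ... | r , a , r≤1 , refl | s , b , s≤1 , refl with halve (c + r + s)
  ...   | r' , c' , r'≤1 , crs≡ = subst (λ m → F m ≤ lg m + F (r + a * 2) + F (s + b * 2)) (sym m≡) (begin
    F (r' + h * 2)                          ≡⟨ F-halve h r'≤1 ⟩
    h + F h                                 ≤⟨ +-monoʳ-≤ h (go f c' a b c'≤1 (half-≤ i≤) (half-≤ j≤)) ⟩
    h + (lg h + F a + F b)                  ≡⟨ regroup c' a b (lg h) (F a) (F b) ⟩
    (c' + lg h) + (a + F a) + (b + F b)     ≤⟨ +-monoˡ-≤ _ (+-monoˡ-≤ _ (lg-carry h r' c'≤1 c'≤h)) ⟩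
    lg (r' + h * 2) + (a + F a) + (b + F b) ≡⟨ cong₂ (λ x y → lg (r' + h * 2) + x + y) (F-halve a r≤1) (F-halve b s≤1) ⟨
    lg (r' + h * 2) + F (r + a * 2) + F (s + b * 2) ∎)
    where
    open ≤-Reasoning
    h = c' + a + b
    c'≤h : c' ≤ h
    c'≤h = ≤-trans (m≤m+n c' a) (m≤m+n (c' + a) b)
    c'≤1 : c' ≤ 1
    c'≤1 = carry≤1 r' (subst (_≤ 3) crs≡ (+-mono-≤ (+-mono-≤ c≤1 r≤1) s≤1))
    m≡ : c + (r + a * 2) + (s + b * 2) ≡ r' + h * 2
    m≡ = begin-equality
      c + (r + a * 2) + (s + b * 2) ≡⟨ split c r a s b ⟩
      (c + r + s) + (a + b) * 2      ≡⟨ cong (_+ (a + b) * 2) crs≡ ⟩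
      (r' + c' * 2) + (a + b) * 2    ≡⟨ merge r' c' a b ⟩
      r' + h * 2                     ∎
      where
      split : ∀ c r a s b → c + (r + a * 2) + (s + b * 2) ≡ (c + r + s) + (a + b) * 2
      split = solve-∀
      merge : ∀ r' c' a b → (r' + c' * 2) + (a + b) * 2 ≡ r' + (c' + a + b) * 2
      merge = solve-∀
    regroup : ∀ c' a b l x y → (c' + a + b) + (l + x + y) ≡ (c' + l) + (a + x) + (b + y)
    regroup = solve-∀

-- The binary digit sum m − F(m) of m is at most lg(m+1).
digits-bound : ∀ m → m ≤ F m + lg (suc m)
digits-bound m = go m m ≤-refl
  where
  lg-step : ∀ {r} a → r ≤ 1 → r + lg (suc a) ≤ lg (suc (r + a * 2))
  lg-step a z≤n       = ⌊log₂⌋-mono-≤ (s≤s (m≤m*n a 2))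
  lg-step a (s≤s z≤n) = lg-carry (suc a) 0 (s≤s z≤n) (s≤s z≤n)

  go : ∀ f m → m ≤ f → m ≤ F m + lg (suc m)
  go zero zero _ = z≤n
  go (suc f) m m≤ with halve m
  ... | r , a , r≤1 , refl = begin
    r + a * 2                          ≡⟨ split r a ⟩
    a + (a + r)                        ≤⟨ +-monoʳ-≤ a (+-monoˡ-≤ r (go f a (half-≤ m≤))) ⟩
    a + (F a + lg (suc a) + r)         ≡⟨ regroup a (F a) (lg (suc a)) r ⟩
    (a + F a) + (r + lg (suc a))       ≤⟨ +-mono-≤ (≤-reflexive (sym (F-halve a r≤1))) (lg-step a r≤1) ⟩
    F (r + a * 2) + lg (suc (r + a * 2)) ∎
    where
    open ≤-Reasoning
    split : ∀ r a → r + a * 2 ≡ a + (a + r)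
    split = solve-∀
    regroup : ∀ a x l r → a + (x + l + r) ≡ (a + x) + (r + l)
    regroup = solve-∀

P′*!≡! : ∀ {x r} → r ≤ x → (x P′ r) * (x ∸ r) ! ≡ x !
P′*!≡! {x} {r} r≤x = trans (cong (_* (x ∸ r) !) (nP′k≡n!/[n∸k]! r≤x)) (m/n*n≡m {{(x ∸ r) !≢0}} [x∸r]!∣x!)
  where [x∸r]!∣x! = ∣-trans (n∣m*n (r !)) (k![n∸k]!∣n! r≤x)

C*!≡P′ : ∀ {x r} → r ≤ x → (x C r) * r ! ≡ x P′ r
C*!≡P′ {x} {r} r≤x = begin
  (x C r) * r !                  ≡⟨ cong (_* r !) (nCk≡nPk/k! r≤x) ⟩
  ((x P r) / r !) * r !          ≡⟨ cong (λ z → (z / r !) * r !) P≡P′ ⟩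
  ((x P′ r) / r !) * r !         ≡⟨ m/n*n≡m (k!∣nP′k r≤x) ⟩
  x P′ r                         ∎
  where
  open ≡-Reasoning
  instance _ = r !≢0
  P≡P′ : x P r ≡ x P′ r
  P≡P′ = trans (nPk≡n!/[n∸k]! r≤x) (sym (nP′k≡n!/[n∸k]! r≤x))

P′-nonZero : ∀ {x r} → r ≤ x → NonZero (x P′ r)
P′-nonZero {x} {r} r≤x = m*n≢0⇒m≢0 (x P′ r) {{subst NonZero (sym (P′*!≡! r≤x)) (x !≢0)}}

C-nonZero : ∀ {x r} → r ≤ x → NonZero (x C r)
C-nonZero {x} {r} r≤x = m*n≢0⇒m≢0 (x C r) {{subst NonZero (sym (C*!≡P′ r≤x)) (P′-nonZero r≤x)}}

ν-P′ : ∀ {x r} → r ≤ x → ν₂ℕ (x P′ r) + F (x ∸ r) ≡ F x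
ν-P′ {x} {r} r≤x = trans (sym (ν-* (x P′ r) ((x ∸ r) !) {{P′-nonZero r≤x}} {{(x ∸ r) !≢0}})) (cong ν₂ℕ (P′*!≡! r≤x))

record Shift (e x r : ℕ) : Set where
  field
    diff      : ℕ
    shifted   : (x + 2 ^ e) P′ r ≡ x P′ r + diff
    ν-shifted : ν₂ℕ ((x + 2 ^ e) P′ r) ≡ ν₂ℕ (x P′ r)
    diff-div  : 2 ^ (e + ν₂ℕ (x P′ r)) ∣ 2 ^ lg x * diff

-- One factor of the induction: the new difference y·D + 2^e·P is again divisible.
diff-step : ∀ e M y P P′ D → ν₂ℕ y ≤ M → 2 ^ ν₂ℕ P ∣ P′ → 2 ^ (e + ν₂ℕ P) ∣ 2 ^ M * D →
            2 ^ (ν₂ℕ y + (e + ν₂ℕ P)) ∣ 2 ^ M * (y * D + 2 ^ e * P′)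
diff-step e M y P P′ D νy≤M 2^νP∣P′ D-div = subst (2 ^ (ν₂ℕ y + (e + ν₂ℕ P)) ∣_) (sym (*-distribˡ-+ (2 ^ M) _ _))
  (∣m∣n⇒∣m+n first second)
  where
  2^ν≡ : 2 ^ (ν₂ℕ y + (e + ν₂ℕ P)) ≡ 2 ^ ν₂ℕ y * (2 ^ e * 2 ^ ν₂ℕ P)
  2^ν≡ = trans (^-distribˡ-+-* 2 (ν₂ℕ y) _) (cong (2 ^ ν₂ℕ y *_) (^-distribˡ-+-* 2 e (ν₂ℕ P)))
  swap* : ∀ a b c → a * (b * c) ≡ b * (a * c)
  swap* = solve-∀
  first : 2 ^ (ν₂ℕ y + (e + ν₂ℕ P)) ∣ 2 ^ M * (y * D)
  first = subst₂ _∣_ (sym (^-distribˡ-+-* 2 (ν₂ℕ y) _)) (swap* y (2 ^ M) D) (*-pres-∣ (pow-ν∣ y) D-div)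
  second : 2 ^ (ν₂ℕ y + (e + ν₂ℕ P)) ∣ 2 ^ M * (2 ^ e * P′)
  second = subst (_∣ 2 ^ M * (2 ^ e * P′)) (sym 2^ν≡) (*-pres-∣ (pow-∣ νy≤M) (*-pres-∣ (∣-refl {2 ^ e}) 2^νP∣P′))

shift : ∀ e x r → r ≤ x → x < 2 ^ e → Shift e x r
shift e x zero    _   _    = record { diff = 0 ; shifted = refl ; ν-shifted = refl
                                    ; diff-div = subst (2 ^ (e + 0) ∣_) (sym (*-zeroʳ (2 ^ lg x))) (_ ∣0) }
shift e x (suc r) r<x x<E = record
  { diff      = y * D + E * PN
  ; shifted   = shifted′
  ; ν-shifted = ν-shifted′
  ; diff-div  = subst (λ v → 2 ^ v ∣ 2 ^ lg x * (y * D + E * PN)) exponent≡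
                  (diff-step e (lg x) y Pn PN D νy≤lg (subst (λ v → 2 ^ v ∣ PN) ν-shifted (pow-ν∣ PN)) diff-div)
  }
  where
  open Shift (shift e x r (<⇒≤ r<x) x<E) renaming (diff to D)
  E = 2 ^ e
  y = x ∸ r
  Pn = x P′ r
  PN = (x + E) P′ r
  instance
    y≢0 : NonZero y
    y≢0 = >-nonZero (m<n⇒0<n∸m r<x)
    Pn≢0 : NonZero Pn
    Pn≢0 = P′-nonZero (<⇒≤ r<x)
    PN≢0 : NonZero PN
    PN≢0 = P′-nonZero (≤-trans (<⇒≤ r<x) (m≤m+n x E))
  swap+ : ∀ a b c → a + (b + c) ≡ b + (a + c)
  swap+ = solve-∀
  top≡ : (x + E) ∸ r ≡ y + E
  top≡ = +-∸-comm E (<⇒≤ r<x)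
  νy≤lg : ν₂ℕ y ≤ lg x
  νy≤lg = ≤-trans (ν≤lg y) (⌊log₂⌋-mono-≤ (m∸n≤m x r))
  ν-yPn : ν₂ℕ (y * Pn) ≡ ν₂ℕ y + ν₂ℕ Pn
  ν-yPn = ν-* y Pn
  exponent≡ : ν₂ℕ y + (e + ν₂ℕ Pn) ≡ e + ν₂ℕ (y * Pn)
  exponent≡ = trans (swap+ (ν₂ℕ y) e (ν₂ℕ Pn)) (cong (_+_ e) (sym ν-yPn))
  shifted′ : ((x + E) ∸ r) * PN ≡ y * Pn + (y * D + E * PN)
  shifted′ = begin
    ((x + E) ∸ r) * PN            ≡⟨ cong (_* PN) top≡ ⟩
    (y + E) * PN                  ≡⟨ *-distribʳ-+ PN y E ⟩
    y * PN + E * PN               ≡⟨ cong (λ z → y * z + E * PN) shifted ⟩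
    y * (Pn + D) + E * PN         ≡⟨ cong (_+ E * PN) (*-distribˡ-+ y Pn D) ⟩
    y * Pn + y * D + E * PN       ≡⟨ +-assoc (y * Pn) (y * D) (E * PN) ⟩
    y * Pn + (y * D + E * PN)     ∎
    where open ≡-Reasoning
  ν-shifted′ : ν₂ℕ (((x + E) ∸ r) * PN) ≡ ν₂ℕ (y * Pn)
  ν-shifted′ = begin
    ν₂ℕ (((x + E) ∸ r) * PN)      ≡⟨ cong (λ z → ν₂ℕ (z * PN)) top≡ ⟩
    ν₂ℕ ((y + E) * PN)            ≡⟨ ν-* (y + E) PN {{>-nonZero (≤-trans (m<n⇒0<n∸m r<x) (m≤m+n y E))}} ⟩
    ν₂ℕ (y + E) + ν₂ℕ PN          ≡⟨ cong₂ _+_ (ν-+-higher y E (pow-∣ (ν<exponent e (≤-<-trans (m∸n≤m x r) x<E)))) ν-shifted ⟩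
    ν₂ℕ y + ν₂ℕ Pn                ≡⟨ ν-yPn ⟨
    ν₂ℕ (y * Pn)                  ∎
    where open ≡-Reasoning

-- Bound p q x: "ν(x) ≥ p − q" for an unnormalised rational x, phrased over ℕ:
-- 2^(p + ν(denominator)) divides 2^q · |numerator|.  (Trivially true for x = 0.)
record Bound (p q : ℕ) (x : ℚᵘ) : Set where
  constructor bound
  field
    pow∣num : 2 ^ (p + ν₂ℕ (ℚᵘ.↧ₙ x)) ∣ 2 ^ q * ∣ ℚᵘ.↥ x ∣

∣-scaled-+ : ∀ {K} m a b → K ∣ m * ∣ a ∣ → K ∣ m * ∣ b ∣ → K ∣ m * ∣ a ℤ.+ b ∣
∣-scaled-+ {K} m a b K∣a K∣b = subst (K ∣_) (trans (cong ∣_∣ (sym (ℤP.*-distribˡ-+ (+ m) a b))) (ℤP.abs-* (+ m) (a ℤ.+ b)))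
  (ℤ∣.∣⇒∣ᵤ {+ K} (ℤ∣.∣m∣n⇒∣m+n (signed a K∣a) (signed b K∣b)))
  where
  signed : ∀ z → K ∣ m * ∣ z ∣ → (+ K) ℤ∣.∣ (+ m ℤ.* z)
  signed z K∣z = ℤ∣.∣ᵤ⇒∣ {+ K} {+ m ℤ.* z} (subst (K ∣_) (sym (ℤP.abs-* (+ m) z)) K∣z)

bound-cong : ∀ {p q x y} → x ≃ y → Bound p q x → Bound p q y
bound-cong {p} {q} {mkℚᵘ a d} {mkℚᵘ b d′} (*≡* ad′≡bd) (bound bound-x) = bound (
  pow∣-cancel (p + ν₂ℕ (suc d′)) (2 ^ q * ∣ b ∣) (suc d) (subst₂ _∣_ exponent≡ cross≡ (*-pres-∣ bound-x (pow-ν∣ (suc d′)))))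
  where
  exponent≡ : 2 ^ (p + ν₂ℕ (suc d)) * 2 ^ ν₂ℕ (suc d′) ≡ 2 ^ (p + ν₂ℕ (suc d′) + ν₂ℕ (suc d))
  exponent≡ = trans (sym (^-distribˡ-+-* 2 (p + ν₂ℕ (suc d)) (ν₂ℕ (suc d′)))) (cong (2 ^_) (swap p (ν₂ℕ (suc d)) (ν₂ℕ (suc d′))))
    where
    swap : ∀ x y z → x + y + z ≡ x + z + y
    swap x y z = trans (+-assoc x y z) (trans (cong (_+_ x) (+-comm y z)) (sym (+-assoc x z y)))
  cross≡ : 2 ^ q * ∣ a ∣ * suc d′ ≡ 2 ^ q * ∣ b ∣ * suc d
  cross≡ = begin
    2 ^ q * ∣ a ∣ * suc d′      ≡⟨ *-assoc (2 ^ q) ∣ a ∣ (suc d′) ⟩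
    2 ^ q * (∣ a ∣ * suc d′)    ≡⟨ cong (2 ^ q *_) (trans (sym (ℤP.abs-* a (+ suc d′))) (trans (cong ∣_∣ ad′≡bd) (ℤP.abs-* b (+ suc d)))) ⟩
    2 ^ q * (∣ b ∣ * suc d)     ≡⟨ *-assoc (2 ^ q) ∣ b ∣ (suc d) ⟨
    2 ^ q * ∣ b ∣ * suc d       ∎
    where open ≡-Reasoning

bound-+ : ∀ {p q x y} → Bound p q x → Bound p q y → Bound p q (x ℚᵘ.+ y)
bound-+ {p} {q} {mkℚᵘ a d} {mkℚᵘ b d′} (bound bound-x) (bound bound-y) = bound (
  ∣-scaled-+ (2 ^ q) (a ℤ.* + D′) (b ℤ.* + D)
    (subst (_∣ 2 ^ q * ∣ a ℤ.* + D′ ∣) (split (ν₂ℕ D) (ν₂ℕ D′) refl) (term a D′ bound-x))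
    (subst (_∣ 2 ^ q * ∣ b ℤ.* + D ∣) (split (ν₂ℕ D′) (ν₂ℕ D) (+-comm (ν₂ℕ D′) (ν₂ℕ D))) (term b D bound-y)))
  where
  D = suc d
  D′ = suc d′
  ν-DD′ : ν₂ℕ (D * D′) ≡ ν₂ℕ D + ν₂ℕ D′
  ν-DD′ = ν-* D D′
  split : ∀ v₁ v₂ → v₁ + v₂ ≡ ν₂ℕ D + ν₂ℕ D′ → 2 ^ (p + v₁) * 2 ^ v₂ ≡ 2 ^ (p + ν₂ℕ (D * D′))
  split v₁ v₂ v₁+v₂≡ = trans (sym (^-distribˡ-+-* 2 (p + v₁) v₂))
    (cong (2 ^_) (trans (+-assoc p v₁ v₂) (cong (_+_ p) (trans v₁+v₂≡ (sym ν-DD′)))))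
  term : ∀ {v} z D₂ → 2 ^ (p + v) ∣ 2 ^ q * ∣ z ∣ → 2 ^ (p + v) * 2 ^ ν₂ℕ D₂ ∣ 2 ^ q * ∣ z ℤ.* + D₂ ∣
  term {v} z D₂ h = subst (2 ^ (p + v) * 2 ^ ν₂ℕ D₂ ∣_) (trans (*-assoc (2 ^ q) ∣ z ∣ D₂) (cong (2 ^ q *_) (sym (ℤP.abs-* z (+ D₂)))))
    (*-pres-∣ h (pow-ν∣ D₂))

bound-weaken : ∀ {p q q′} x → q ≤ q′ → Bound p q x → Bound p q′ x
bound-weaken (mkℚᵘ a d) q≤q′ (bound bnd) = bound (∣-trans bnd (*-monoˡ-∣ ∣ a ∣ (pow-∣ q≤q′)))

-- A bound for X/A − Y/B, whose numerator X·B − Y·A equals U − V when X·B + V = Y·A + U: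
-- it suffices that 2^(p + ν(A·B)) divides both 2^q·U and 2^q·V.
bound-frac-diff : ∀ {p q} X A Y B U V .{{_ : NonZero A}} .{{_ : NonZero B}} →
                  X * B + V ≡ Y * A + U →
                  2 ^ (p + ν₂ℕ (A * B)) ∣ 2 ^ q * U → 2 ^ (p + ν₂ℕ (A * B)) ∣ 2 ^ q * V →
                  Bound p q ((+ X) ℚᵘ./ A ℚᵘ.- (+ Y) ℚᵘ./ B)
bound-frac-diff {p} {q} X A@(suc _) Y B@(suc _) U V eq K∣U K∣V = bound (
  subst (λ z → K ∣ 2 ^ q * ∣ z ∣) (sym numerator≡)
    (∣-scaled-+ (2 ^ q) (+ U) (ℤ.- + V) K∣U (subst (λ z → K ∣ 2 ^ q * z) (sym (ℤP.∣-i∣≡∣i∣ (+ V))) K∣V)))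
  where
  K = 2 ^ (p + ν₂ℕ (A * B))
  cross≡ : + X ℤ.* + B ℤ.+ + V ≡ + Y ℤ.* + A ℤ.+ + U
  cross≡ = begin
    + X ℤ.* + B ℤ.+ + V   ≡⟨ cong (ℤ._+ + V) (ℤP.pos-* X B) ⟨
    + (X * B) ℤ.+ + V     ≡⟨ ℤP.pos-+ (X * B) V ⟨
    + (X * B + V)         ≡⟨ cong +_ eq ⟩
    + (Y * A + U)         ≡⟨ ℤP.pos-+ (Y * A) U ⟩
    + (Y * A) ℤ.+ + U     ≡⟨ cong (ℤ._+ + U) (ℤP.pos-* Y A) ⟩
    + Y ℤ.* + A ℤ.+ + U   ∎
    where open ≡-Reasoning
  numerator≡ : + X ℤ.* + B ℤ.+ ℤ.- + Y ℤ.* + A ≡ + U ℤ.+ ℤ.- + V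
  numerator≡ = begin
    + X ℤ.* + B ℤ.+ ℤ.- + Y ℤ.* + A                          ≡⟨ add-both (+ X) (+ B) (+ Y) (+ A) (+ V) ⟩
    (+ X ℤ.* + B ℤ.+ + V) ℤ.- (+ Y ℤ.* + A ℤ.+ + V)        ≡⟨ cong (ℤ._- (+ Y ℤ.* + A ℤ.+ + V)) cross≡ ⟩
    (+ Y ℤ.* + A ℤ.+ + U) ℤ.- (+ Y ℤ.* + A ℤ.+ + V)        ≡⟨ cancel (+ Y) (+ A) (+ U) (+ V) ⟩
    + U ℤ.+ ℤ.- + V                                          ∎
    where
    open ≡-Reasoning
    add-both : ∀ x b y a v → x ℤ.* b ℤ.+ ℤ.- y ℤ.* a ≡ (x ℤ.* b ℤ.+ v) ℤ.- (y ℤ.* a ℤ.+ v)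
    add-both = ℤ-Solver.solve-∀
    cancel : ∀ y a u v → (y ℤ.* a ℤ.+ u) ℤ.- (y ℤ.* a ℤ.+ v) ≡ u ℤ.+ ℤ.- v
    cancel = ℤ-Solver.solve-∀

diff≤diff : ∀ p q a b → p + b ≤ a + q → + p ℤ.- + q ℤ.≤ + a ℤ.- + b
diff≤diff p q a b p+b≤a+q = begin
  + p ℤ.- + q                        ≡⟨ add-both (+ p) (+ q) (+ b) ⟩
  (+ p ℤ.+ + b) ℤ.- (+ q ℤ.+ + b)    ≤⟨ ℤP.+-monoˡ-≤ (ℤ.- (+ q ℤ.+ + b)) (subst₂ ℤ._≤_ (ℤP.pos-+ p b) (ℤP.pos-+ a q) (ℤ.+≤+ p+b≤a+q)) ⟩
  (+ a ℤ.+ + q) ℤ.- (+ q ℤ.+ + b)    ≡⟨ cancel (+ a) (+ q) (+ b) ⟩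
  + a ℤ.- + b                        ∎
  where
  open ℤP.≤-Reasoning
  add-both : ∀ p q b → p ℤ.- q ≡ (p ℤ.+ b) ℤ.- (q ℤ.+ b)
  add-both = ℤ-Solver.solve-∀
  cancel : ∀ a q b → (a ℤ.+ q) ℤ.- (q ℤ.+ b) ≡ a ℤ.- b
  cancel = ℤ-Solver.solve-∀

bound⇒νAtLeast : ∀ p q x → Bound p q (toℚᵘ x) → νAtLeast (+ p ℤ.- + q) x
bound⇒νAtLeast p q x@(mkℚ a d _) (bound bnd) with ∣ a ∣ ≟ 0
... | yes ∣a∣≡0 = inj₁ (ℚP.↥p≡0⇒p≡0 x (ℤP.∣i∣≡0⇒i≡0 ∣a∣≡0))
... | no  ∣a∣≢0 = inj₂ (diff≤diff p q (ν₂ℕ ∣ a ∣) (ν₂ℕ (suc d))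
        (subst (p + ν₂ℕ (suc d) ≤_) (+-comm q _) (pow∣pow*⇒≤ (p + ν₂ℕ (suc d)) q ∣ a ∣ {{≢-nonZero ∣a∣≢0}} bnd)))

Boundℚ : ℕ → ℕ → ℚ → Set
Boundℚ p q x = Bound p q (toℚᵘ x)

boundℚ-+ : ∀ {p q x y} → Boundℚ p q x → Boundℚ p q y → Boundℚ p q (x ℚ.+ y)
boundℚ-+ {x = x} {y} bx by = bound-cong (ℚᵘP.≃-sym (ℚP.toℚᵘ-homo-+ x y)) (bound-+ bx by)

frac-≃ : ∀ X A Y B .{{_ : NonZero A}} .{{_ : NonZero B}} → X * B ≡ Y * A → (+ X) ℚᵘ./ A ≃ (+ Y) ℚᵘ./ B
frac-≃ X A@(suc _) Y B@(suc _) XB≡YA = *≡* (trans (sym (ℤP.pos-* X B)) (trans (cong +_ XB≡YA) (ℤP.pos-* Y A)))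

frac-+ : ∀ X A Y B Z C .{{_ : NonZero A}} .{{_ : NonZero B}} .{{_ : NonZero C}} →
         (X * B + Y * A) * C ≡ Z * (A * B) → (+ X) ℚᵘ./ A ℚᵘ.+ (+ Y) ℚᵘ./ B ≃ (+ Z) ℚᵘ./ C
frac-+ X A@(suc _) Y B@(suc _) Z C@(suc _) eq = *≡* (begin
  (+ X ℤ.* + B ℤ.+ + Y ℤ.* + A) ℤ.* + C  ≡⟨ cong₂ (λ u v → (u ℤ.+ v) ℤ.* + C) (ℤP.pos-* X B) (ℤP.pos-* Y A) ⟨
  (+ (X * B) ℤ.+ + (Y * A)) ℤ.* + C      ≡⟨ cong (ℤ._* + C) (ℤP.pos-+ (X * B) (Y * A)) ⟨
  + (X * B + Y * A) ℤ.* + C              ≡⟨ ℤP.pos-* (X * B + Y * A) C ⟨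
  + ((X * B + Y * A) * C)                ≡⟨ cong +_ eq ⟩
  + (Z * (A * B))                        ≡⟨ ℤP.pos-* Z (A * B) ⟩
  + Z ℤ.* + (A * B)                      ∎)
  where open ≡-Reasoning

recip-binom : ∀ {x r} (r≤x : r ≤ x) →
              let instance _ = C-nonZero r≤x; _ = P′-nonZero r≤x in
              (+ 1) ℚᵘ./ (x C r) ≃ (+ (r !)) ℚᵘ./ (x P′ r)
recip-binom {x} {r} r≤x = frac-≃ 1 (x C r) (r !) (x P′ r) {{C-nonZero r≤x}} {{P′-nonZero r≤x}}
  (trans (+-identityʳ (x P′ r)) (trans (sym (C*!≡P′ r≤x)) (*-comm (x C r) (r !))))

recip-binom-pair : ∀ {x a} (a<x : suc a ≤ x) →
                   let instance _ = C-nonZero (<⇒≤ a<x); _ = C-nonZero a<x; _ = P′-nonZero a<x in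
                   (+ 1) ℚᵘ./ (x C a) ℚᵘ.+ (+ 1) ℚᵘ./ (x C suc a) ≃ (+ (a ! * (x + 1))) ℚᵘ./ (x P′ suc a)
recip-binom-pair {x} {a} a<x = frac-+ 1 C₀ 1 C₁ (a ! * (x + 1)) P₁ {{C-nonZero (<⇒≤ a<x)}} {{C-nonZero a<x}} {{P′-nonZero a<x}} (begin
  (1 * C₁ + 1 * C₀) * P₁                          ≡⟨ cong₂ (λ u v → (u + v) * P₁) (*-identityˡ C₁) (*-identityˡ C₀) ⟩
  (C₁ + C₀) * P₁                                  ≡⟨ *-distribʳ-+ P₁ C₁ C₀ ⟩
  C₁ * P₁ + C₀ * P₁                               ≡⟨ cong₂ _+_ (cong (C₁ *_) P₁≡[x∸a]P₀) (cong (C₀ *_) (sym (C*!≡P′ a<x))) ⟩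
  C₁ * ((x ∸ a) * (C₀ * a !)) + C₀ * (C₁ * (suc a * a !)) ≡⟨ collect C₀ C₁ (x ∸ a) (a !) a ⟩
  a ! * ((x ∸ a) + suc a) * (C₀ * C₁)            ≡⟨ cong (λ z → a ! * z * (C₀ * C₁)) x∸a+1+a≡x+1 ⟩
  a ! * (x + 1) * (C₀ * C₁)                      ∎)
  where
  open ≡-Reasoning
  C₀ = x C a
  C₁ = x C suc a
  P₁ = x P′ suc a
  P₁≡[x∸a]P₀ : P₁ ≡ (x ∸ a) * (C₀ * a !)
  P₁≡[x∸a]P₀ = cong ((x ∸ a) *_) (sym (C*!≡P′ (<⇒≤ a<x)))
  x∸a+1+a≡x+1 : (x ∸ a) + suc a ≡ x + 1
  x∸a+1+a≡x+1 = trans (+-suc (x ∸ a) a) (trans (cong suc (m∸n+n≡m (<⇒≤ a<x))) (+-comm 1 x))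
  collect : ∀ c₀ c₁ y f a → c₁ * (y * (c₀ * f)) + c₀ * (c₁ * (suc a * f)) ≡ f * (y + suc a) * (c₀ * c₁)
  collect = solve-∀

toℚᵘ-inv-diff : ∀ A B .{{_ : NonZero A}} .{{_ : NonZero B}} →
                toℚᵘ (inv A ℚ.- inv B) ≃ (+ 1) ℚᵘ./ A ℚᵘ.- (+ 1) ℚᵘ./ B
toℚᵘ-inv-diff A@(suc a) B@(suc b) = ℚᵘP.≃-trans (ℚP.toℚᵘ-homo-+ (inv A) (ℚ.- inv B))
  (ℚᵘP.+-cong (ℚP.toℚᵘ-fromℚᵘ (mkℚᵘ (+ 1) a))
              (ℚᵘP.≃-trans (ℚP.toℚᵘ-homo‿- (inv B)) (ℚᵘP.-‿cong (ℚP.toℚᵘ-fromℚᵘ (mkℚᵘ (+ 1) b)))))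

T′ : ℕ → ℕ → ℕ → ℚ
T′ e n r = inv ((n + 2 ^ e) C r) ℚ.- inv (n C r)

term-bound : ∀ e n r q → r ≤ n → n < 2 ^ e → ν₂ℕ (n P′ r) + lg n ≤ q + F r → Boundℚ e q (T′ e n r)
term-bound e n r q r≤n n<2^e ineq =
  bound-cong (ℚᵘP.≃-sym T′≃) (bound-frac-diff (r !) PN (r !) Pn 0 (r ! * D) cross zero-div D-div)
  where
  open Shift (shift e n r r≤n n<2^e) renaming (diff to D)
  N = n + 2 ^ e
  r≤N : r ≤ N
  r≤N = ≤-trans r≤n (m≤m+n n (2 ^ e))
  Pn = n P′ r
  PN = N P′ r
  π = ν₂ℕ Pn
  instance
    _ = P′-nonZero r≤n
    _ = P′-nonZero r≤N
    _ = C-nonZero r≤n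
    _ = C-nonZero r≤N
  T′≃ : toℚᵘ (T′ e n r) ≃ (+ (r !)) ℚᵘ./ PN ℚᵘ.- (+ (r !)) ℚᵘ./ Pn
  T′≃ = ℚᵘP.≃-trans (toℚᵘ-inv-diff (N C r) (n C r)) (ℚᵘP.+-cong (recip-binom r≤N) (ℚᵘP.-‿cong (recip-binom r≤n)))
  cross : r ! * Pn + r ! * D ≡ r ! * PN + 0
  cross = trans (sym (*-distribˡ-+ (r !) Pn D)) (trans (cong (r ! *_) (sym shifted)) (sym (+-identityʳ _)))
  ν-PNPn : ν₂ℕ (PN * Pn) ≡ π + π
  ν-PNPn = trans (ν-* PN Pn) (cong (_+ π) ν-shifted)
  zero-div : 2 ^ (e + ν₂ℕ (PN * Pn)) ∣ 2 ^ q * 0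
  zero-div = subst (2 ^ (e + ν₂ℕ (PN * Pn)) ∣_) (sym (*-zeroʳ (2 ^ q))) (_ ∣0)
  regroup : ∀ l e π → l + (e + (π + π)) ≡ (e + π) + (π + l)
  regroup = solve-∀
  D-div : 2 ^ (e + ν₂ℕ (PN * Pn)) ∣ 2 ^ q * (r ! * D)
  D-div = pow∣-scale (e + π) (lg n) D _ q (r !) {{r !≢0}} diff-div (begin
    lg n + (e + ν₂ℕ (PN * Pn))   ≡⟨ cong (λ v → lg n + (e + v)) ν-PNPn ⟩
    lg n + (e + (π + π))        ≡⟨ regroup (lg n) e π ⟩
    (e + π) + (π + lg n)         ≤⟨ +-monoʳ-≤ (e + π) ineq ⟩
    (e + π) + (q + F r)          ∎)
    where open ≤-Reasoning

regroup-diffs : ∀ a b c d → (a ℚᵘ.- b) ℚᵘ.+ (c ℚᵘ.- d) ≃ (a ℚᵘ.+ c) ℚᵘ.- (b ℚᵘ.+ d)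
regroup-diffs = solve 4 (λ a b c d → (a :- b) :+ (c :- d) := (a :+ c) :- (b :+ d)) ℚᵘP.≃-refl
  where open +-*-Solver

pair-bound : ∀ e n a s q → suc a ≤ n → n < 2 ^ e →
             s + ν₂ℕ (n P′ suc a) ≤ q + F a →
             lg n + s + ν₂ℕ (n P′ suc a) ≤ q + F a + ν₂ℕ (n + 1) →
             Boundℚ (e + s) q (T′ e n a ℚ.+ T′ e n (suc a))
pair-bound e n a s q a<n n<2^e ineq₁ ineq₂ =
  bound-cong (ℚᵘP.≃-sym pair≃) (bound-frac-diff X PN Y Pn U V cross U-div V-div)
  where
  open Shift (shift e n (suc a) a<n n<2^e) renaming (diff to D)
  E = 2 ^ e
  N = n + E
  a<N : suc a ≤ N
  a<N = ≤-trans a<n (m≤m+n n E)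
  Pn = n P′ suc a
  PN = N P′ suc a
  π = ν₂ℕ Pn
  X = a ! * (N + 1)
  Y = a ! * (n + 1)
  U = a ! * E * Pn
  V = a ! * (n + 1) * D
  instance
    _ = P′-nonZero a<n
    _ = P′-nonZero a<N
    _ = C-nonZero a<n
    _ = C-nonZero a<N
    _ = C-nonZero (<⇒≤ a<n)
    _ = C-nonZero (<⇒≤ a<N)
    _ = a !≢0
    _ = m^n≢0 2 e
    n+1≢0 : NonZero (n + 1)
    n+1≢0 = >-nonZero (m≤n+m 1 n)
  pair≃ : toℚᵘ (T′ e n a ℚ.+ T′ e n (suc a)) ≃ (+ X) ℚᵘ./ PN ℚᵘ.- (+ Y) ℚᵘ./ Pn
  pair≃ = ℚᵘP.≃-trans (ℚP.toℚᵘ-homo-+ (T′ e n a) (T′ e n (suc a)))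
          (ℚᵘP.≃-trans (ℚᵘP.+-cong (toℚᵘ-inv-diff (N C a) (n C a)) (toℚᵘ-inv-diff (N C suc a) (n C suc a)))
          (ℚᵘP.≃-trans (regroup-diffs ((+ 1) ℚᵘ./ (N C a)) ((+ 1) ℚᵘ./ (n C a)) ((+ 1) ℚᵘ./ (N C suc a)) ((+ 1) ℚᵘ./ (n C suc a)))
                       (ℚᵘP.+-cong (recip-binom-pair a<N) (ℚᵘP.-‿cong (recip-binom-pair a<n)))))
  cross : X * Pn + V ≡ Y * PN + U
  cross = trans (expand (a !) n E Pn D) (cong (λ z → Y * z + U) (sym shifted))
    where
    expand : ∀ f n E p d → f * (n + E + 1) * p + f * (n + 1) * d ≡ f * (n + 1) * (p + d) + f * E * p
    expand = solve-∀
  ν-PNPn : ν₂ℕ (PN * Pn) ≡ π + π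
  ν-PNPn = trans (ν-* PN Pn) (cong (_+ π) ν-shifted)
  ν-U : ν₂ℕ U ≡ F a + e + π
  ν-U = trans (ν-* (a ! * E) Pn {{m*n≢0 (a !) E}}) (cong (_+ π) (trans (ν-* (a !) E) (cong (_+_ (F a)) (ν-pow e))))
  ν-Y : ν₂ℕ Y ≡ F a + ν₂ℕ (n + 1)
  ν-Y = ν-* (a !) (n + 1)
  U-div : 2 ^ (e + s + ν₂ℕ (PN * Pn)) ∣ 2 ^ q * U
  U-div = ≤⇒pow∣pow* _ q U {{m*n≢0 (a ! * E) Pn {{m*n≢0 (a !) E}}}} (begin
    e + s + ν₂ℕ (PN * Pn)    ≡⟨ cong (_+_ (e + s)) ν-PNPn ⟩
    e + s + (π + π)          ≡⟨ regroup e s π ⟩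
    (e + π) + (s + π)        ≤⟨ +-monoʳ-≤ (e + π) ineq₁ ⟩
    (e + π) + (q + F a)      ≡⟨ regroup′ e π q (F a) ⟩
    q + (F a + e + π)        ≡⟨ cong (_+_ q) ν-U ⟨
    q + ν₂ℕ U                ∎)
    where
    open ≤-Reasoning
    regroup : ∀ e s π → e + s + (π + π) ≡ (e + π) + (s + π)
    regroup = solve-∀
    regroup′ : ∀ e π q f → (e + π) + (q + f) ≡ q + (f + e + π)
    regroup′ = solve-∀
  V-div : 2 ^ (e + s + ν₂ℕ (PN * Pn)) ∣ 2 ^ q * V
  V-div = pow∣-scale (e + π) (lg n) D _ q Y {{m*n≢0 (a !) (n + 1)}} diff-div (begin
    lg n + (e + s + ν₂ℕ (PN * Pn))   ≡⟨ cong (λ v → lg n + (e + s + v)) ν-PNPn ⟩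
    lg n + (e + s + (π + π))         ≡⟨ regroup (lg n) e s π ⟩
    (e + π) + (lg n + s + π)         ≤⟨ +-monoʳ-≤ (e + π) ineq₂ ⟩
    (e + π) + (q + F a + ν₂ℕ (n + 1)) ≡⟨ cong (_+_ (e + π)) (trans (+-assoc q (F a) _) (cong (_+_ q) (sym ν-Y))) ⟩
    (e + π) + (q + ν₂ℕ Y)            ∎)
    where
    open ≤-Reasoning
    regroup : ∀ l e s π → l + (e + s + (π + π)) ≡ (e + π) + (l + s + π)
    regroup = solve-∀

sum-by-pairs : ∀ (B : ℚ → Set) → (∀ {x y} → B x → B y → B (x ℚ.+ y)) → ∀ f m →
               (∀ i → i ≤ m → B (f (i * 2) ℚ.+ f (suc (i * 2)))) → B (sumUpTo f (suc (m * 2)))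
sum-by-pairs B B-+ f zero    pairs = pairs 0 z≤n
sum-by-pairs B B-+ f (suc m) pairs = subst B (sym (ℚP.+-assoc (sumUpTo f (suc (m * 2))) _ _))
  (B-+ (sum-by-pairs B B-+ f m (λ i i≤m → pairs i (m≤n⇒m≤1+n i≤m))) (pairs (suc m) ≤-refl))

sum-by-pairs-and-last : ∀ (B : ℚ → Set) → (∀ {x y} → B x → B y → B (x ℚ.+ y)) → ∀ f m →
                        (∀ i → suc i ≤ m → B (f (i * 2) ℚ.+ f (suc (i * 2)))) → B (f (m * 2)) →
                        B (sumUpTo f (m * 2))
sum-by-pairs-and-last B B-+ f zero    pairs last = last
sum-by-pairs-and-last B B-+ f (suc m) pairs last = B-+ (sum-by-pairs B B-+ f m (λ i i≤m → pairs i (s≤s i≤m))) last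

-- 2k + 1 = 1 + k·2, the shape used by Legendre's recursion.
odd≡ : ∀ k → 2 * k + 1 ≡ 1 + k * 2
odd≡ = solve-∀

-- The pair inequality behind part (a), for k = i + j: with π = ν((2k+1) P′ (2i+1)),
-- ν(k+1) + π ≤ lg(k+1) + F(2i).  It is the carry bound for i + j + 1, doubled.
pair-inequality : ∀ k i → i ≤ k → ν₂ℕ (k + 1) + ν₂ℕ ((2 * k + 1) P′ suc (2 * i)) ≤ lg (k + 1) + F (2 * i)
pair-inequality k i i≤k with m≤n⇒∃[o]m+o≡n i≤k
-- from here on k is i + j; the rewrites bring k + 1, 2k + 1 and 2i into Legendre's shapes
... | j , refl rewrite +-comm (i + j) 1 | odd≡ (i + j) | *-comm 2 i = +-cancelʳ-≤ (F (j * 2)) _ _ (begin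
  ν₂ℕ (suc k) + π + F (j * 2)                ≡⟨ +-assoc (ν₂ℕ (suc k)) π _ ⟩
  ν₂ℕ (suc k) + (π + F (j * 2))              ≡⟨ cong (_+_ (ν₂ℕ (suc k))) π+F≡ ⟩
  ν₂ℕ (suc k) + (k + F k)                    ≡⟨ x+[y+z]≡y+[x+z] (ν₂ℕ (suc k)) k (F k) ⟩
  k + (ν₂ℕ (suc k) + F k)                    ≡⟨ cong (_+_ k) (F-suc k) ⟨
  k + F (suc k)                              ≤⟨ +-monoʳ-≤ k (carry-bound 1 i j (s≤s z≤n)) ⟩
  k + (lg (suc k) + F i + F j)               ≡⟨ regroup i j (lg (suc k)) (F i) (F j) ⟩
  lg (suc k) + (i + F i) + (j + F j)         ≡⟨ cong₂ (λ x y → lg (suc k) + x + y) (F-double i) (F-double j) ⟨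
  lg (suc k) + F (i * 2) + F (j * 2)         ∎)
  where
  open ≤-Reasoning
  n = 1 + k * 2
  π = ν₂ℕ (n P′ suc (i * 2))
  n∸a≡ : n ∸ suc (i * 2) ≡ j * 2
  n∸a≡ = trans (cong (_∸ suc (i * 2)) (split i j)) (m+n∸m≡n (suc (i * 2)) (j * 2))
    where
    split : ∀ i j → 1 + (i + j) * 2 ≡ suc (i * 2) + j * 2
    split = solve-∀
  π+F≡ : π + F (j * 2) ≡ k + F k
  π+F≡ = trans (cong (λ m → π + F m) (sym n∸a≡))
               (trans (ν-P′ (s≤s (*-monoˡ-≤ 2 (m≤m+n i j)))) (F-double+1 k))
  x+[y+z]≡y+[x+z] : ∀ x y z → x + (y + z) ≡ y + (x + z)
  x+[y+z]≡y+[x+z] = solve-∀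
  regroup : ∀ i j l x y → (i + j) + (l + x + y) ≡ l + (i + x) + (j + y)
  regroup = solve-∀

-- The inequality behind part (b), for even k = 2a: with π = ν((2k+1) P′ k),
-- π + lg(2k+1) ≤ 2 lg(k+2) + F(k).  It is the digit bound a ≤ F(a) + lg(a+1).
middle-inequality : ∀ a → let k = a * 2 in ν₂ℕ ((2 * k + 1) P′ k) + lg (2 * k + 1) ≤ 2 * lg (k + 2) + F k
-- the rewrites bring 2k + 1 and k + 2 into Legendre's shapes
middle-inequality a rewrite odd≡ (a * 2) | +-comm (a * 2) 2 = +-cancelʳ-≤ (F (suc k)) _ _ (begin
  π + lg n + F (suc k)                        ≡⟨ +-comm-middle π (lg n) (F (suc k)) ⟩
  (π + F (suc k)) + lg n                      ≡⟨ cong (_+ lg n) π+F≡ ⟩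
  (k + F k) + lg n                            ≡⟨ cong (λ x → (k + x) + lg n) (F-double a) ⟩
  (a * 2 + (a + F a)) + lg n                  ≡⟨ regroup a (F a) (lg n) ⟩
  (a + lg n) + (a + F a) + a                  ≤⟨ +-monoˡ-≤ a (+-monoˡ-≤ (a + F a) a+lg-n≤) ⟩
  (Q + F a) + (a + F a) + a                   ≡⟨ regroup′ Q a (F a) ⟩
  Q + (a + F a) + (a + F a)                   ≡⟨ cong₂ (λ x y → Q + x + y) (F-double a) (F-double+1 a) ⟨
  Q + F k + F (suc k)                         ∎)
  where
  open ≤-Reasoning
  k = a * 2
  n = 1 + k * 2
  π = ν₂ℕ (n P′ k)
  Q = 2 * lg (suc (suc k))
  π+F≡ : π + F (suc k) ≡ k + F k
  π+F≡ = trans (cong (λ m → π + F m) (sym n∸k≡)) (trans (ν-P′ k≤n) (F-double+1 k))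
    where
    n∸k≡ : n ∸ k ≡ suc k
    n∸k≡ = trans (cong (_∸ k) (split k)) (m+n∸n≡m (suc k) k)
      where
      split : ∀ k → 1 + k * 2 ≡ suc k + k
      split = solve-∀
    k≤n : k ≤ n
    k≤n = ≤-trans (m≤m*n k 2) (n≤1+n (k * 2))
  lg-n≤ : lg n ≤ suc (suc (lg (suc a)))
  lg-n≤ = begin
    lg n                       ≤⟨ ⌊log₂⌋-mono-≤ (m≤n+m n 3) ⟩
    lg (suc a * 2 * 2)         ≡⟨ lg-double (suc a * 2) ⟩
    suc (lg (suc a * 2))       ≡⟨ cong suc (lg-double (suc a)) ⟩
    suc (suc (lg (suc a)))     ∎
  a+lg-n≤ : a + lg n ≤ Q + F a
  a+lg-n≤ = begin
    a + lg n                                   ≤⟨ +-mono-≤ (digits-bound a) lg-n≤ ⟩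
    F a + lg (suc a) + suc (suc (lg (suc a)))  ≡⟨ collect (F a) (lg (suc a)) ⟩
    2 * suc (lg (suc a)) + F a                 ≡⟨ cong (λ l → 2 * l + F a) (lg-double (suc a)) ⟨
    Q + F a                                    ∎
    where
    collect : ∀ f l → f + l + suc (suc l) ≡ 2 * suc l + f
    collect = solve-∀
  +-comm-middle : ∀ x y z → x + y + z ≡ (x + z) + y
  +-comm-middle = solve-∀
  regroup : ∀ a f l → (a * 2 + (a + f)) + l ≡ (a + l) + (a + f) + a
  regroup = solve-∀
  regroup′ : ∀ q a f → (q + f) + (a + f) + a ≡ q + (a + f) + (a + f)
  regroup′ = solve-∀

odd<2^e : ∀ e k → 1 ≤ e → k < 2 ^ (e ∸ 1) → 2 * k + 1 < 2 ^ e
odd<2^e (suc e) k _ k<2^e-1 = begin-strict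
  2 * k + 1    <⟨ ≤-reflexive (double+2 k) ⟩
  2 * suc k    ≤⟨ *-monoʳ-≤ 2 k<2^e-1 ⟩
  2 * 2 ^ e    ∎
  where
  open ≤-Reasoning
  double+2 : ∀ k → suc (2 * k + 1) ≡ 2 * suc k
  double+2 = solve-∀

T≡T′ : ∀ e k r → T e k r ≡ T′ e (2 * k + 1) r
T≡T′ e k r = cong (λ N → inv (N C r) ℚ.- inv ((2 * k + 1) C r)) (reorder (2 ^ e) k)
  where
  reorder : ∀ E k → E + 2 * k + 1 ≡ 2 * k + 1 + E
  reorder = solve-∀

part-a : ∀ e k i → 2 * k + 1 < 2 ^ e → 2 * i + 1 ≤ k →
         Boundℚ (e + 2 * ν₂ℕ (k + 1)) (2 * lg (k + 1)) (T e k (2 * i) ℚ.+ T e k (2 * i + 1))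
part-a e k i n<2^e 2i+1≤k = subst (Boundℚ (e + 2 * t) (2 * L)) (sym pair≡)
  (pair-bound e n (2 * i) (2 * t) (2 * L) a<n n<2^e ineq₁ ineq₂)
  where
  n = 2 * k + 1
  t = ν₂ℕ (k + 1)
  L = lg (k + 1)
  π = ν₂ℕ (n P′ suc (2 * i))
  a<n : suc (2 * i) ≤ n
  a<n = ≤-trans (≤-reflexive (+-comm 1 (2 * i))) (≤-trans 2i+1≤k (≤-trans (m≤n*m k 2) (m≤m+n (2 * k) 1)))
  pair≡ : T e k (2 * i) ℚ.+ T e k (2 * i + 1) ≡ T′ e n (2 * i) ℚ.+ T′ e n (suc (2 * i))
  pair≡ = cong₂ ℚ._+_ (T≡T′ e k (2 * i)) (trans (T≡T′ e k (2 * i + 1)) (cong (T′ e n) (+-comm (2 * i) 1)))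
  t+π≤ : t + π ≤ L + F (2 * i)
  t+π≤ = pair-inequality k i (≤-trans (m≤m*n i 2) (≤-trans (≤-reflexive (*-comm i 2)) (≤-trans (m≤m+n (2 * i) 1) 2i+1≤k)))
  t≤L : t ≤ L
  t≤L = ν≤lg (k + 1) {{>-nonZero (m≤n+m 1 k)}}
  ν[n+1]≡ : ν₂ℕ (n + 1) ≡ suc t
  ν[n+1]≡ = trans (cong ν₂ℕ (double k)) (ν-double (k + 1) {{>-nonZero (m≤n+m 1 k)}})
    where
    double : ∀ m → 2 * m + 1 + 1 ≡ (m + 1) * 2
    double = solve-∀
  lg-n≤ : lg n ≤ suc L
  lg-n≤ = ≤-trans (⌊log₂⌋-mono-≤ (m≤n+m n 1)) (≤-reflexive (trans (cong lg (double k)) (lg-double (k + 1) {{>-nonZero (m≤n+m 1 k)}})))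
    where
    double : ∀ k → 1 + (2 * k + 1) ≡ (k + 1) * 2
    double = solve-∀
  ineq₁ : 2 * t + π ≤ 2 * L + F (2 * i)
  ineq₁ = begin
    2 * t + π          ≡⟨ split t π ⟩
    t + (t + π)        ≤⟨ +-mono-≤ t≤L t+π≤ ⟩
    L + (L + F (2 * i)) ≡⟨ split L (F (2 * i)) ⟨
    2 * L + F (2 * i)   ∎
    where
    open ≤-Reasoning
    split : ∀ x y → 2 * x + y ≡ x + (x + y)
    split = solve-∀
  ineq₂ : lg n + 2 * t + π ≤ 2 * L + F (2 * i) + ν₂ℕ (n + 1)
  ineq₂ = begin
    lg n + 2 * t + π                ≡⟨ split (lg n) t π ⟩
    (lg n + t) + (t + π)            ≤⟨ +-mono-≤ (+-monoˡ-≤ t lg-n≤) t+π≤ ⟩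
    (suc L + t) + (L + F (2 * i))   ≡⟨ merge L t (F (2 * i)) ⟩
    2 * L + F (2 * i) + suc t       ≡⟨ cong (_+_ (2 * L + F (2 * i))) ν[n+1]≡ ⟨
    2 * L + F (2 * i) + ν₂ℕ (n + 1) ∎
    where
    open ≤-Reasoning
    split : ∀ l t π → l + 2 * t + π ≡ (l + t) + (t + π)
    split = solve-∀
    merge : ∀ L t f → (suc L + t) + (L + f) ≡ 2 * L + f + suc t
    merge = solve-∀

even-half : ∀ k → k % 2 ≡ 0 → ∃ λ a → k ≡ a * 2
even-half k k%2≡0 with halve k
... | 0 , a , _ , refl = a , refl
... | suc (suc _) , _ , s≤s () , _
... | 1 , a , _ , refl with trans (sym ([m+kn]%n≡m%n 1 a 2)) k%2≡0
...   | ()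

part-b : ∀ e k → 2 * k + 1 < 2 ^ e → k % 2 ≡ 0 → Boundℚ e (2 * lg (k + 2)) (T e k k)
part-b e k n<2^e k-even with even-half k k-even
... | a , refl = subst (Boundℚ e (2 * lg (k + 2))) (sym (T≡T′ e k k))
  (term-bound e (2 * k + 1) k (2 * lg (k + 2)) (≤-trans (m≤n*m k 2) (m≤m+n (2 * k) 1)) n<2^e (middle-inequality a))

-- Part (a) as needed in the full sum: with the weaker q = 2 lg(k+2), and the pair
-- indexed as i * 2, suc (i * 2).
pair-in-sum : ∀ e k i → 2 * k + 1 < 2 ^ e → 2 * i + 1 ≤ k →
              Boundℚ (e + 2 * ν₂ℕ (k + 1)) (2 * lg (k + 2)) (T e k (i * 2) ℚ.+ T e k (suc (i * 2)))
pair-in-sum e k i n<2^e 2i+1≤k = subst (Boundℚ (e + 2 * ν₂ℕ (k + 1)) (2 * lg (k + 2))) index≡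
  (bound-weaken (toℚᵘ (T e k (2 * i) ℚ.+ T e k (2 * i + 1))) q≤q′ (part-a e k i n<2^e 2i+1≤k))
  where
  index≡ : T e k (2 * i) ℚ.+ T e k (2 * i + 1) ≡ T e k (i * 2) ℚ.+ T e k (suc (i * 2))
  index≡ = cong₂ (λ a b → T e k a ℚ.+ T e k b) (*-comm 2 i) (odd≡ i)
  q≤q′ : 2 * lg (k + 1) ≤ 2 * lg (k + 2)
  q≤q′ = *-monoʳ-≤ 2 (⌊log₂⌋-mono-≤ (+-monoʳ-≤ k (n≤1+n 1)))

-- The full sum: pair up the terms, adding the middle term T_k when k is even.
part-sum : ∀ e k → 2 * k + 1 < 2 ^ e →
           Boundℚ (e + 2 * ν₂ℕ (k + 1)) (2 * lg (k + 2)) (sumUpTo (T e k) k)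
part-sum e k n<2^e with halve k
... | suc (suc _) , _ , s≤s () , _
... | 1 , m , _ , refl = sum-by-pairs (Boundℚ _ _) boundℚ-+ (T e k) m
  (λ i i≤m → pair-in-sum e k i n<2^e (≤-trans (≤-reflexive (odd≡ i)) (s≤s (*-monoˡ-≤ 2 i≤m))))
... | 0 , m , _ , refl = sum-by-pairs-and-last (Boundℚ _ _) boundℚ-+ (T e k) m
  (λ i i<m → pair-in-sum e k i n<2^e (≤-trans (≤-reflexive (odd≡ i)) (≤-trans (n≤1+n _) (*-monoˡ-≤ 2 i<m))))
  (subst (λ p → Boundℚ p (2 * lg (k + 2)) (T e k k)) (sym e+2ν≡e) (part-b e k n<2^e (m*n%n≡0 m 2)))
  where
  e+2ν≡e : e + 2 * ν₂ℕ (k + 1) ≡ e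
  e+2ν≡e = trans (cong (λ v → e + 2 * v) (trans (cong ν₂ℕ (+-comm k 1)) (ν-odd m))) (+-identityʳ e)

bound⇒νAtLeast′ : ∀ e t q x → Boundℚ (e + t) q x → νAtLeast (+ e ℤ.- + q ℤ.+ + t) x
bound⇒νAtLeast′ e t q x bnd = subst (λ m → νAtLeast m x) exponent≡ (bound⇒νAtLeast (e + t) q x bnd)
  where
  exponent≡ : + (e + t) ℤ.- + q ≡ + e ℤ.- + q ℤ.+ + t
  exponent≡ = trans (cong (ℤ._- + q) (ℤP.pos-+ e t)) (reorder (+ e) (+ t) (+ q))
    where
    reorder : ∀ e t q → e ℤ.+ t ℤ.- q ≡ e ℤ.- q ℤ.+ t
    reorder = ℤ-Solver.solve-∀

theorem2p2 : (e k : ℕ) → 1 ≤ e → k < 2 ^ (e ∸ 1) →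
    νAtLeast ((+ e) ℤ.- (+ (2 * lg (k + 2))) ℤ.+ (+ (2 * ν₂ℕ (k + 1)))) (sumUpTo (T e k) k)
    × ((i : ℕ) → 2 * i + 1 ≤ k →
        νAtLeast ((+ e) ℤ.- (+ (2 * lg (k + 1))) ℤ.+ (+ (2 * ν₂ℕ (k + 1))))
                 (T e k (2 * i) ℚ.+ T e k (2 * i + 1)))
    × (k % 2 ≡ 0 → νAtLeast ((+ e) ℤ.- (+ (2 * lg (k + 2)))) (T e k k))
theorem2p2 e k 1≤e k<2^[e∸1] =
    bound⇒νAtLeast′ e _ _ _ (part-sum e k n<2^e)
  , (λ i 2i+1≤k → bound⇒νAtLeast′ e _ _ _ (part-a e k i n<2^e 2i+1≤k))
  , (λ k-even → bound⇒νAtLeast e _ _ (part-b e k n<2^e k-even))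
  where
  n<2^e : 2 * k + 1 < 2 ^ e
  n<2^e = odd<2^e e k 1≤e k<2^[e∸1]
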